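{- Let $r$ be a positive integer, let $p_1,\dots,p_r$ be distinct primes, let $e_1,\dots,e_r$ be positive integers, and let $M=\max_{i\in[r]}p_i^{e_i}$. For a Boolean function $f:\{0,1\}^n\to\{0,1\}$ let $d_{\max}(f)=\max_{i\in[r]} d_{p_i^{e_i}}(f)$. Then almost every non-symmetric $f:\{0,1\}^n\to\{0,1\}$ satisfies $$d_{\max}(f)>\frac{(\lg n-1)^{1/r}}{M},$$ i.e. the fraction of non-symmetric $f:\{0,1\}^n\to\{0,1\}$ satisfying this inequality tends to $1$ as $n\to\infty$.
   Context: $\lg$ denotes logarithm base $2$. $f$ is symmetric if $f(x)$ depends only on $\sum_i x_i$. For an integer $q\ge 2$, $d_q(f)$ denotes the total degree of the unique multilinear polynomial $P\in\mathbb{Z}_q[x_1,\dots,x_n]$ with $P(x)\equiv f(x)\pmod q$ for all $x\in\{0,1\}^n$, where $\mathbb{Z}_q$ is the ring of integers modulo $q$. -}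

module Defs where

open import Data.Bool using (Bool; true; false; if_then_else_)
open import Data.Nat using (ℕ; zero; suc; _+_; _*_; _^_; _≤_; _<_; _⊔_)
open import Data.Fin using (Fin)
import Data.Fin as F
open import Data.Vec using (Vec; []; _∷_)
open import Data.List using (List; []; _∷_; map; _++_; length)
open import Data.Nat.ListAction using (sum)
open import Data.List.Relation.Unary.AllPairs using (AllPairs)
open import Data.List.Relation.Unary.All using (All)
open import Data.Product using (Σ; ∃; ∃-syntax; _×_; _,_)
open import Data.Sum using (_⊎_)
open import Relation.Binary.PropositionalEquality using (_≡_; _≢_)
open import Relation.Nullary using (¬_)

-- Points of {0,1}^n, and also subsets S ⊆ [n] (as characteristic vectors)
Cube : ℕ → Set
Cube n = Vec Bool n

BoolFun : ℕ → Set
BoolFun n = Cube n → Bool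

b2n : Bool → ℕ
b2n true = 1
b2n false = 0

weight : ∀ {n} → Cube n → ℕ
weight [] = 0
weight (b ∷ x) = b2n b + weight x

allCube : ∀ n → List (Cube n)
allCube zero = [] ∷ []
allCube (suc n) = map (false ∷_) (allCube n) ++ map (true ∷_) (allCube n)

Symmetric : ∀ {n} → BoolFun n → Set
Symmetric {n} f = ∀ (x y : Cube n) → weight x ≡ weight y → f x ≡ f y

NonSymmetric : ∀ {n} → BoolFun n → Set
NonSymmetric f = ¬ Symmetric f

-- A multilinear polynomial over Z_q in x_1..x_n: coefficient c_S for each S ⊆ [n],
-- coefficients given by their representatives in {0,..,q-1}.
MPoly : ℕ → Set
MPoly n = Cube n → ℕ

mono : ∀ {n} → Cube n → Cube n → ℕ
mono [] [] = 1
mono (s ∷ S) (b ∷ x) = (if s then b2n b else 1) * mono S x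

-- evaluation (over ℕ; reduced mod q where compared)
eval : ∀ {n} → MPoly n → Cube n → ℕ
eval {n} c x = sum (map (λ S → c S * mono S x) (allCube n))

ModEq : ℕ → ℕ → ℕ → Set
ModEq q a b = ∃[ k ] ∃[ l ] a + k * q ≡ b + l * q

Represents : ∀ {n} → ℕ → MPoly n → BoolFun n → Set
Represents {n} q c f = (∀ S → c S < q) × (∀ (x : Cube n) → ModEq q (eval c x) (b2n (f x)))

-- total degree of P is d (degree of the zero polynomial taken to be 0)
HasTotalDegree : ∀ {n} → MPoly n → ℕ → Set
HasTotalDegree {n} c d =
  (∀ (S : Cube n) → c S ≢ 0 → weight S ≤ d) × (d ≡ 0 ⊎ ∃[ S ] (c S ≢ 0 × weight S ≡ d))

-- d_q(f) = d : the (unique) multilinear representing polynomial over Z_q has total degree d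
DegMod : ∀ {n} → ℕ → BoolFun n → ℕ → Set
DegMod q f d = ∃[ c ] (Represents q c f × HasTotalDegree c d)

maxFin : ∀ {r} → (Fin r → ℕ) → ℕ
maxFin {zero} g = 0
maxFin {suc r} g = g F.zero ⊔ maxFin (λ i → g (F.suc i))

Distinct : ∀ {n} → List (BoolFun n) → Set
Distinct {n} = AllPairs (λ f g → ¬ (∀ (x : Cube n) → f x ≡ g x))

-- f is non-symmetric and d_max(f) ≤ (lg n - 1)^{1/r} / M, written in integer form:
-- d_max > (lg n - 1)^{1/r}/M  ⇔  n < 2^((d_max·M)^r + 1)
Bad : ∀ {r} (n : ℕ) → (Fin r → ℕ) → ℕ → BoolFun n → Set
Bad {r} n q M f = NonSymmetric f ×
  ∃[ ds ] ((∀ i → DegMod (q i) f (ds i)) × 2 ^ ((maxFin ds * M) ^ r + 1) ≤ n)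

module Submission where

-- A Boolean function whose representing polynomial modulo q has degree < L is determined by the
-- coefficients of its at most (n+1)^L monomials of degree < L, hence there are at most q^((n+1)^L) such
-- functions. A function violating the bound has d_{q₁}(f) < ⌊lg n⌋ =: L, so there are at most
-- q^(2^((L+1)L)) of them, whereas every function of n − 2 variables extends to a distinct non-symmetric
-- function of n variables (values at 10… and 01… fixed to differ), giving 2^(2^(n−2)) of those.
-- As (L+1)L = O(lg² n), the double exponential wins by any factor k once n is large.

open import Data.Bool using (Bool; true; false)
open import Data.Empty using (⊥; ⊥-elim)
open import Data.Fin using (Fin)
import Data.Fin as F
open import Data.Fin.Properties using (injective⇒≤; fromℕ<-injective)
open import Data.List using (List; []; _∷_; length; map; cartesianProductWith; lookup)
open import Data.List.Properties using (length-++; length-map; map-cong)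
open import Data.List.Membership.Propositional.Properties using (∈-lookup)
open import Data.List.Relation.Unary.All using (All; []; _∷_)
import Data.List.Relation.Unary.All as All
import Data.List.Relation.Unary.All.Properties as Allₚ
open import Data.List.Relation.Unary.AllPairs using ([]; _∷_)
open import Data.List.Relation.Unary.Unique.Setoid using (Unique)
import Data.List.Relation.Unary.Unique.Setoid.Properties as Unique
open import Data.Nat using (ℕ; zero; suc; _+_; _*_; _^_; _≤_; _<_; _%_; _≟_; z≤n; s≤s; s≤s⁻¹;
  NonZero; >-nonZero; nonTrivial⇒n>1)
open import Data.Nat.DivMod using ([m+kn]%n≡m%n; m<n⇒m%n≡m)
open import Data.Nat.ListAction using (sum)
open import Data.Nat.Primality using (Prime; prime⇒nonTrivial)
open import Data.Nat.Properties
open import Data.Nat.Tactic.RingSolver using (solve-∀)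
open import Data.Product using (∃-syntax; _×_; _,_; proj₁; proj₂)
open import Data.Sum using (inj₁; inj₂)
open import Data.Vec using ([]; _∷_; replicate)
open import Relation.Binary.Bundles using (Setoid)
open import Relation.Binary.PropositionalEquality
  using (_≡_; _≢_; refl; sym; trans; cong; cong₂; subst; _→-setoid_; module ≡-Reasoning)
open import Relation.Nullary.Decidable using (decidable-stable)

open import Defs

-- Distinct {n} is, by definition, Unique (FunSetoid n).
FunSetoid : ℕ → Setoid _ _
FunSetoid n = Cube n →-setoid Bool

length-cartesianProductWith : ∀ {A B C : Set} (f : A → B → C) xs ys →
  length (cartesianProductWith f xs ys) ≡ length xs * length ys
length-cartesianProductWith f [] ys = refl
length-cartesianProductWith f (x ∷ xs) ys =
  trans (length-++ (map (f x) ys))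
        (cong₂ _+_ (length-map (f x) ys) (length-cartesianProductWith f xs ys))

join : ∀ {n} → BoolFun n → BoolFun n → BoolFun (suc n)
join f g (false ∷ x) = f x
join f g (true ∷ x) = g x

allFuns : ∀ n → List (BoolFun n)
allFuns zero = (λ _ → true) ∷ (λ _ → false) ∷ []
allFuns (suc n) = cartesianProductWith join (allFuns n) (allFuns n)

allFuns-unique : ∀ n → Unique (FunSetoid n) (allFuns n)
allFuns-unique zero = ((λ eq → true≢false (eq [])) ∷ []) ∷ [] ∷ []
  where
  true≢false : true ≡ false → ⊥
  true≢false ()
allFuns-unique (suc n) =
  Unique.cartesianProductWith⁺ (FunSetoid n) (FunSetoid n) (FunSetoid (suc n)) join
    (λ eq → (λ x → eq (false ∷ x)) , (λ x → eq (true ∷ x)))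
    (allFuns-unique n) (allFuns-unique n)

length-allFuns : ∀ n → length (allFuns n) ≡ 2 ^ 2 ^ n
length-allFuns zero = refl
length-allFuns (suc n) = begin
  length (allFuns (suc n))                      ≡⟨ length-cartesianProductWith join (allFuns n) (allFuns n) ⟩
  length (allFuns n) * length (allFuns n)       ≡⟨ cong₂ _*_ (length-allFuns n) (length-allFuns n) ⟩
  2 ^ 2 ^ n * 2 ^ 2 ^ n                         ≡⟨ ^-distribˡ-+-* 2 (2 ^ n) (2 ^ n) ⟨
  2 ^ (2 ^ n + 2 ^ n)                           ≡⟨ cong (λ e → 2 ^ (2 ^ n + e)) (+-identityʳ (2 ^ n)) ⟨
  2 ^ 2 ^ suc n                                 ∎
  where open ≡-Reasoning

nonSymmetricLift : ∀ {n} → BoolFun n → BoolFun (2 + n)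
nonSymmetricLift f (true ∷ false ∷ x) = true
nonSymmetricLift f (false ∷ true ∷ x) = false
nonSymmetricLift f (false ∷ false ∷ x) = f x
nonSymmetricLift f (true ∷ true ∷ x) = f x

nonSymmetricLift-nonSymmetric : ∀ {n} (f : BoolFun n) → NonSymmetric (nonSymmetricLift f)
nonSymmetricLift-nonSymmetric {n} f symmetric
  with symmetric (true ∷ false ∷ replicate n false) (false ∷ true ∷ replicate n false) refl
... | ()

nonSymmetricFuns : ∀ n → ∃[ G ] (Distinct {2 + n} G × All NonSymmetric G × length G ≡ 2 ^ 2 ^ n)
nonSymmetricFuns n =
  map nonSymmetricLift (allFuns n) ,
  Unique.map⁺ (FunSetoid n) (FunSetoid (2 + n)) (λ eq x → eq (false ∷ false ∷ x)) (allFuns-unique n) ,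
  Allₚ.map⁺ (All.universal nonSymmetricLift-nonSymmetric (allFuns n)) ,
  trans (length-map nonSymmetricLift (allFuns n)) (length-allFuns n)

module _ {a ℓ} (S : Setoid a ℓ) where
  open Setoid S using (Carrier; _≈_) renaming (sym to ≈-sym)

  Unique-lookup-injective : ∀ {xs} → Unique S xs → ∀ i j → lookup xs i ≈ lookup xs j → i ≡ j
  Unique-lookup-injective (_ ∷ _) F.zero F.zero _ = refl
  Unique-lookup-injective (x∉xs ∷ xs!) F.zero (F.suc j) eq = ⊥-elim (All.lookup x∉xs (∈-lookup j) eq)
  Unique-lookup-injective (x∉xs ∷ xs!) (F.suc i) F.zero eq = ⊥-elim (All.lookup x∉xs (∈-lookup i) (≈-sym eq))
  Unique-lookup-injective (x∉xs ∷ xs!) (F.suc i) (F.suc j) eq = cong F.suc (Unique-lookup-injective xs! i j eq)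

  length≤-of-separatingCode : ∀ {p} {P : Carrier → Set p} {X xs} → Unique S xs → (ps : All P xs) →
    (code : ∀ {x} → P x → Fin X) → (∀ {x y} (px : P x) (py : P y) → code px ≡ code py → x ≈ y) →
    length xs ≤ X
  length≤-of-separatingCode {X = X} {xs} xs! ps code separates =
    injective⇒≤ {f = codeAt} λ {i} {j} eq → Unique-lookup-injective xs! i j (separates _ _ eq)
    where
    codeAt : Fin (length xs) → Fin X
    codeAt i = code (All.lookup ps (∈-lookup i))

module _ {Q : ℕ} .{{_ : NonZero Q}} where

  digits< : ∀ {a b Q′} → a < Q → b < Q′ → a + b * Q < Q * Q′
  digits< {a} {b} {Q′} a<Q b<Q′ = begin-strict
    a + b * Q   <⟨ +-monoˡ-< (b * Q) a<Q ⟩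
    Q + b * Q   ≡⟨⟩
    suc b * Q   ≤⟨ *-monoˡ-≤ Q b<Q′ ⟩
    Q′ * Q      ≡⟨ *-comm Q′ Q ⟩
    Q * Q′      ∎
    where open ≤-Reasoning

  digits-injective : ∀ {a b a′ b′} → a < Q → a′ < Q → a + b * Q ≡ a′ + b′ * Q → a ≡ a′ × b ≡ b′
  digits-injective {a} {b} {a′} {b′} a<Q a′<Q eq = a≡a′ , b≡b′
    where
    a≡a′ : a ≡ a′
    a≡a′ = begin
      a               ≡⟨ m<n⇒m%n≡m a<Q ⟨
      a % Q           ≡⟨ [m+kn]%n≡m%n a b Q ⟨
      (a + b * Q) % Q ≡⟨ cong (_% Q) eq ⟩
      (a′ + b′ * Q) % Q ≡⟨ [m+kn]%n≡m%n a′ b′ Q ⟩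
      a′ % Q          ≡⟨ m<n⇒m%n≡m a′<Q ⟩
      a′              ∎
      where open ≡-Reasoning
    b≡b′ : b ≡ b′
    b≡b′ = *-cancelʳ-≡ b b′ Q (+-cancelˡ-≡ a (b * Q) (b′ * Q) (trans eq (cong (_+ b′ * Q) (sym a≡a′))))

  modEq⇒%≡ : ∀ {V a} → a < Q → ModEq Q V a → V % Q ≡ a
  modEq⇒%≡ {V} {a} a<Q (k , l , eq) = begin
    V % Q           ≡⟨ [m+kn]%n≡m%n V k Q ⟨
    (V + k * Q) % Q ≡⟨ cong (_% Q) eq ⟩
    (a + l * Q) % Q ≡⟨ [m+kn]%n≡m%n a l Q ⟩
    a % Q           ≡⟨ m<n⇒m%n≡m a<Q ⟩
    a               ∎
    where open ≡-Reasoning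

-- The number of S ⊆ [n] with |S| < L.
lowWeightCount : ℕ → ℕ → ℕ
lowWeightCount n zero = 0
lowWeightCount zero (suc L) = 1
lowWeightCount (suc n) (suc L) = lowWeightCount n (suc L) + lowWeightCount n L

lowWeightCount≤ : ∀ n L → lowWeightCount n L ≤ suc n ^ L
lowWeightCount≤ n zero = z≤n
lowWeightCount≤ zero (suc L) = ≤-reflexive (sym (^-zeroˡ (suc L)))
lowWeightCount≤ (suc n) (suc L) = begin
  lowWeightCount n (suc L) + lowWeightCount n L ≤⟨ +-mono-≤ (lowWeightCount≤ n (suc L)) (lowWeightCount≤ n L) ⟩
  suc n ^ suc L + suc n ^ L                     ≡⟨ +-comm (suc n ^ suc L) (suc n ^ L) ⟩
  suc (suc n) * suc n ^ L                       ≤⟨ *-monoʳ-≤ (suc (suc n)) (^-monoˡ-≤ L (n≤1+n (suc n))) ⟩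
  suc (suc n) ^ suc L                           ∎
  where open ≤-Reasoning

-- slice false c holds the monomials avoiding x₁, slice true c the cofactor of x₁.
slice : ∀ {n} → Bool → MPoly (suc n) → MPoly n
slice b c S = c (b ∷ S)

Reduced : ∀ {n} → ℕ → MPoly n → Set
Reduced q c = ∀ S → c S < q

DegreeBelow : ∀ {n} → ℕ → MPoly n → Set
DegreeBelow L c = ∀ S → c S ≢ 0 → weight S < L

LowDegreeRep : ∀ {n} → ℕ → ℕ → BoolFun n → Set
LowDegreeRep q L f = ∃[ c ] (Represents q c f × DegreeBelow L c)

module LowDegreeCode (q : ℕ) .{{_ : NonZero q}} where

  -- The coefficients of the monomials of degree < L, read as the digits of a base-q numeral.
  lowCode : (n L : ℕ) → MPoly n → ℕ
  lowCode n zero c = 0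
  lowCode zero (suc L) c = c []
  lowCode (suc n) (suc L) c =
    lowCode n (suc L) (slice false c) + lowCode n L (slice true c) * q ^ lowWeightCount n (suc L)

  lowCode< : (n L : ℕ) (c : MPoly n) → Reduced q c → lowCode n L c < q ^ lowWeightCount n L
  lowCode< n zero c _ = s≤s z≤n
  lowCode< zero (suc L) c reduced = subst (c [] <_) (sym (*-identityʳ q)) (reduced [])
  lowCode< (suc n) (suc L) c reduced =
    subst (lowCode (suc n) (suc L) c <_)
          (sym (^-distribˡ-+-* q (lowWeightCount n (suc L)) (lowWeightCount n L)))
          (digits< {{m^n≢0 q (lowWeightCount n (suc L))}}
             (lowCode< n (suc L) (slice false c) (λ S → reduced (false ∷ S)))
             (lowCode< n L (slice true c) (λ S → reduced (true ∷ S))))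

  degreeBelow-zero : ∀ {n} (c : MPoly n) → DegreeBelow 0 c → ∀ S → c S ≡ 0
  degreeBelow-zero c below S = decidable-stable (c S ≟ 0) (λ c≢0 → n≮0 (below S c≢0))

  lowCode-injective : (n L : ℕ) (c c′ : MPoly n) → Reduced q c → Reduced q c′ → DegreeBelow L c → DegreeBelow L c′ →
                      lowCode n L c ≡ lowCode n L c′ → ∀ S → c S ≡ c′ S
  lowCode-injective n zero c c′ _ _ below below′ _ S =
    trans (degreeBelow-zero c below S) (sym (degreeBelow-zero c′ below′ S))
  lowCode-injective zero (suc L) c c′ _ _ _ _ eq [] = eq
  lowCode-injective (suc n) (suc L) c c′ reduced reduced′ below below′ eq = coefficients
    where
    digits : lowCode n (suc L) (slice false c) ≡ lowCode n (suc L) (slice false c′)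
           × lowCode n L (slice true c) ≡ lowCode n L (slice true c′)
    digits = digits-injective {{m^n≢0 q (lowWeightCount n (suc L))}}
               (lowCode< n (suc L) (slice false c) (λ S → reduced (false ∷ S)))
               (lowCode< n (suc L) (slice false c′) (λ S → reduced′ (false ∷ S))) eq
    coefficients : ∀ S → c S ≡ c′ S
    coefficients (false ∷ S) =
      lowCode-injective n (suc L) (slice false c) (slice false c′)
        (λ S → reduced (false ∷ S)) (λ S → reduced′ (false ∷ S))
        (λ S → below (false ∷ S)) (λ S → below′ (false ∷ S)) (proj₁ digits) S
    coefficients (true ∷ S) =
      lowCode-injective n L (slice true c) (slice true c′)
        (λ S → reduced (true ∷ S)) (λ S → reduced′ (true ∷ S))
        (λ S c≢0 → s≤s⁻¹ (below (true ∷ S) c≢0)) (λ S c≢0 → s≤s⁻¹ (below′ (true ∷ S) c≢0)) (proj₂ digits) S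

b2n-injective : ∀ {a b} → b2n a ≡ b2n b → a ≡ b
b2n-injective {true} {true} _ = refl
b2n-injective {false} {false} _ = refl

b2n<2 : ∀ b → b2n b < 2
b2n<2 true = s≤s (s≤s z≤n)
b2n<2 false = s≤s z≤n

eval-cong : ∀ {n} {c c′ : MPoly n} → (∀ S → c S ≡ c′ S) → ∀ x → eval c x ≡ eval c′ x
eval-cong {n} c≗c′ x = cong sum (map-cong (λ S → cong (_* mono S x) (c≗c′ S)) (allCube n))

module LowDegreeCount (q : ℕ) (2≤q : 2 ≤ q) where
  instance
    q≢0 : NonZero q
    q≢0 = >-nonZero (≤-trans (s≤s z≤n) 2≤q)

  open LowDegreeCode q

  represented-by-same⇒≗ : ∀ {n} {c c′ : MPoly n} {f g} → Represents q c f → Represents q c′ g →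
                          (∀ S → c S ≡ c′ S) → ∀ x → f x ≡ g x
  represented-by-same⇒≗ {c = c} {c′} {f} {g} (_ , c≅f) (_ , c′≅g) c≗c′ x = b2n-injective (begin
    b2n (f x)       ≡⟨ modEq⇒%≡ (≤-trans (b2n<2 (f x)) 2≤q) (c≅f x) ⟨
    eval c x % q    ≡⟨ cong (_% q) (eval-cong c≗c′ x) ⟩
    eval c′ x % q   ≡⟨ modEq⇒%≡ (≤-trans (b2n<2 (g x)) 2≤q) (c′≅g x) ⟩
    b2n (g x)       ∎)
    where open ≡-Reasoning

  lowDegree-count : ∀ {n} L {B : List (BoolFun n)} → Distinct B → All (LowDegreeRep q L) B →
                    length B ≤ q ^ lowWeightCount n L
  lowDegree-count {n} L B! reps = length≤-of-separatingCode (FunSetoid n) B! reps code separates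
    where
    code : ∀ {f} → LowDegreeRep q L f → Fin (q ^ lowWeightCount n L)
    code (c , (reduced , _) , _) = F.fromℕ< (lowCode< n L c reduced)
    separates : ∀ {f g} (rf : LowDegreeRep q L f) (rg : LowDegreeRep q L g) → code rf ≡ code rg → ∀ x → f x ≡ g x
    separates (c , rep , below) (c′ , rep′ , below′) eq =
      represented-by-same⇒≗ rep rep′
        (lowCode-injective n L c c′ (proj₁ rep) (proj₁ rep′) below below′ (fromℕ<-injective _ _ _ _ eq))

n<2^n : ∀ n → n < 2 ^ n
n<2^n zero = s≤s z≤n
n<2^n (suc n) = begin-strict
  suc n              ≤⟨ n<2^n n ⟩
  2 ^ n              <⟨ m<m+n (2 ^ n) (m^n>0 2 n) ⟩
  2 ^ n + 2 ^ n      ≡⟨ cong (2 ^ n +_) (+-identityʳ (2 ^ n)) ⟨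
  2 ^ suc n          ∎
  where open ≤-Reasoning

^≤2^* : ∀ q E → q ^ E ≤ 2 ^ (q * E)
^≤2^* q E = ≤-trans (^-monoˡ-≤ E (<⇒≤ (n<2^n q))) (≤-reflexive (^-*-assoc 2 q E))

m≤m^[1+n] : ∀ m n → m ≤ m ^ suc n
m≤m^[1+n] zero n = z≤n
m≤m^[1+n] (suc m) n = m≤m*n (suc m) (suc m ^ n) {{m^n≢0 (suc m) n}}

∃-log₂ : ∀ n → 1 ≤ n → ∃[ L ] (2 ^ L ≤ n × n < 2 ^ suc L)
∃-log₂ (suc zero) _ = 0 , s≤s z≤n , s≤s (s≤s z≤n)
∃-log₂ (suc (suc n)) _ with ∃-log₂ (suc n) (s≤s z≤n)
... | L , 2^L≤ , <2^L+1 with m≤n⇒m<n∨m≡n <2^L+1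
...   | inj₁ 2+n<2^L+1 = L , m≤n⇒m≤1+n 2^L≤ , 2+n<2^L+1
...   | inj₂ 2+n≡2^L+1 = suc L , ≤-reflexive (sym 2+n≡2^L+1) ,
                         subst (_< 2 ^ suc (suc L)) (sym 2+n≡2^L+1) (^-monoʳ-< 2 (s≤s (s≤s z≤n)) (n<1+n (suc L)))

≤-log₂ : ∀ {a n L} → 2 ^ a ≤ n → n < 2 ^ suc L → a ≤ L
≤-log₂ {a} 2^a≤n n<2^L+1 = ≮⇒≥ λ L<a → <⇒≱ n<2^L+1 (≤-trans (^-monoʳ-≤ 2 L<a) 2^a≤n)

square<2^ : ∀ {L} → 6 ≤ L → suc L * suc L < 2 ^ L
square<2^ 6≤L with m≤n⇒∃[o]m+o≡n 6≤L
... | t , refl = go t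
  where
  expand : ∀ t → (8 + t) * (8 + t) + (34 + (12 * t + t * t)) ≡ (7 + t) * (7 + t) + (7 + t) * (7 + t)
  expand = solve-∀
  go : ∀ t → (7 + t) * (7 + t) < 2 ^ (6 + t)
  go zero = ≤ᵇ⇒≤ 50 64 _
  go (suc t) = begin-strict
    (8 + t) * (8 + t)                            ≤⟨ m≤m+n _ _ ⟩
    (8 + t) * (8 + t) + (34 + (12 * t + t * t))  ≡⟨ expand t ⟩
    (7 + t) * (7 + t) + (7 + t) * (7 + t)        <⟨ +-mono-< (go t) (go t) ⟩
    2 ^ (6 + t) + 2 ^ (6 + t)                    ≡⟨ cong (2 ^ (6 + t) +_) (+-identityʳ (2 ^ (6 + t))) ⟨
    2 ^ (7 + t)                                  ∎
    where open ≤-Reasoning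

lowWeightCount≤2^ : ∀ {n L} → n < 2 ^ suc L → lowWeightCount n L ≤ 2 ^ (suc L * L)
lowWeightCount≤2^ {n} {L} n<2^L+1 = begin
  lowWeightCount n L     ≤⟨ lowWeightCount≤ n L ⟩
  suc n ^ L              ≤⟨ ^-monoˡ-≤ L n<2^L+1 ⟩
  (2 ^ suc L) ^ L        ≡⟨ ^-*-assoc 2 (suc L) L ⟩
  2 ^ (suc L * L)        ∎
  where open ≤-Reasoning

exponent-bound : ∀ {C L m} → 6 + C ≤ L → 2 ^ L ≤ 2 + m → C + suc L * L ≤ m
exponent-bound {C} {L} {m} 6+C≤L 2^L≤2+m = s≤s⁻¹ (s≤s⁻¹ (begin
  2 + (C + suc L * L)    ≤⟨ s≤s (s≤s (+-monoˡ-≤ (suc L * L) (≤-trans (m≤n+m C 6) 6+C≤L))) ⟩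
  2 + (L + suc L * L)    ≡⟨ cong suc (*-suc (suc L) L) ⟨
  suc (suc L * suc L)    ≤⟨ square<2^ (≤-trans (m≤m+n 6 C) 6+C≤L) ⟩
  2 ^ L                  ≤⟨ 2^L≤2+m ⟩
  2 + m                  ∎))
  where open ≤-Reasoning

count≤doubleExp : ∀ k q L {m} → 2 ^ L ≤ 2 + m → 2 + m < 2 ^ suc L → 6 + (k + q) ≤ L →
                  k * q ^ lowWeightCount (2 + m) L ≤ 2 ^ 2 ^ m
count≤doubleExp k q L {m} 2^L≤n n<2^L+1 6+C≤L = begin
  k * q ^ lowWeightCount (2 + m) L   ≤⟨ *-mono-≤ (<⇒≤ (n<2^n k)) q^E≤ ⟩
  2 ^ k * 2 ^ (q * Y)                ≡⟨ ^-distribˡ-+-* 2 k (q * Y) ⟨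
  2 ^ (k + q * Y)                    ≤⟨ ^-monoʳ-≤ 2 exponent≤ ⟩
  2 ^ 2 ^ m                          ∎
  where
  open ≤-Reasoning
  Y : ℕ
  Y = 2 ^ (suc L * L)
  instance
    Y≢0 : NonZero Y
    Y≢0 = m^n≢0 2 (suc L * L)
  q^E≤ : q ^ lowWeightCount (2 + m) L ≤ 2 ^ (q * Y)
  q^E≤ = ≤-trans (^≤2^* q _) (^-monoʳ-≤ 2 (*-monoʳ-≤ q (lowWeightCount≤2^ {L = L} n<2^L+1)))
  exponent≤ : k + q * Y ≤ 2 ^ m
  exponent≤ = begin
    k + q * Y              ≤⟨ +-monoˡ-≤ (q * Y) (m≤m*n k Y) ⟩
    k * Y + q * Y          ≡⟨ *-distribʳ-+ Y k q ⟨
    (k + q) * Y            ≤⟨ *-monoˡ-≤ Y (<⇒≤ (n<2^n (k + q))) ⟩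
    2 ^ (k + q) * Y        ≡⟨ ^-distribˡ-+-* 2 (k + q) (suc L * L) ⟨
    2 ^ (k + q + suc L * L) ≤⟨ ^-monoʳ-≤ 2 (exponent-bound 6+C≤L 2^L≤n) ⟩
    2 ^ m                  ∎

bad⇒lowDegreeRep : ∀ {r n L} {q : Fin (suc r) → ℕ} {f : BoolFun n} → 1 ≤ maxFin q → n < 2 ^ suc L →
                   Bad n q (maxFin q) f → LowDegreeRep (q F.zero) L f
bad⇒lowDegreeRep {r} {n} {L} {q} 1≤M n<2^L+1 (_ , ds , degMod , 2^[E+1]≤n) with degMod F.zero
... | c , rep , (bounded , _) = c , rep , weight<L
  where
  D : ℕ
  D = maxFin ds
  D≤E : D ≤ (D * maxFin q) ^ suc r
  D≤E = ≤-trans (m≤m*n D (maxFin q) {{>-nonZero 1≤M}}) (m≤m^[1+n] (D * maxFin q) r)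
  weight<L : DegreeBelow L c
  weight<L S c≢0 = subst (_≤ L) (+-comm (weight S) 1) (≤-log₂ 2^[w+1]≤n n<2^L+1)
    where
    w≤E : weight S ≤ (D * maxFin q) ^ suc r
    w≤E = ≤-trans (bounded S c≢0) (≤-trans (m≤m⊔n (ds F.zero) _) D≤E)
    2^[w+1]≤n : 2 ^ (weight S + 1) ≤ n
    2^[w+1]≤n = ≤-trans (^-monoʳ-≤ 2 (+-monoˡ-≤ 1 w≤E)) 2^[E+1]≤n

lowDegree-outnumbered : ∀ {q} → 2 ≤ q → ∀ k L {n} → 2 ^ (6 + (k + q)) ≤ n → 2 ^ L ≤ n → n < 2 ^ suc L →
  ∀ {B : List (BoolFun n)} → Distinct B → All (LowDegreeRep q L) B →
  ∃[ G ] (Distinct {n} G × All (NonSymmetric {n}) G × k * length B ≤ length G)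
lowDegree-outnumbered {q} 2≤q k L N≤n 2^L≤n n<2^L+1 {B} B! reps
  with m≤n⇒∃[o]m+o≡n (≤-trans (*-monoʳ-≤ 2 (m^n>0 2 (5 + (k + q)))) N≤n)
... | m , refl with nonSymmetricFuns m
...   | G , G! , nonSymmetric , |G|≡2^2^m = G , G! , nonSymmetric , (begin
  k * length B                      ≤⟨ *-monoʳ-≤ k (LowDegreeCount.lowDegree-count q 2≤q L B! reps) ⟩
  k * q ^ lowWeightCount (2 + m) L  ≤⟨ count≤doubleExp k q L 2^L≤n n<2^L+1 (≤-log₂ N≤n n<2^L+1) ⟩
  2 ^ 2 ^ m                         ≡⟨ |G|≡2^2^m ⟨
  length G                          ∎)
  where open ≤-Reasoning

2≤prime^ : ∀ {p e} → Prime p → 1 ≤ e → 2 ≤ p ^ e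
2≤prime^ {p} {suc e} p-prime _ = ≤-trans (nonTrivial⇒n>1 p {{prime⇒nonTrivial p-prime}}) (m≤m^[1+n] p e)

mainTheorem8 : (r : ℕ) → 1 ≤ r → (p e : Fin r → ℕ) →
    (∀ i → Prime (p i)) → (∀ i j → p i ≡ p j → i ≡ j) → (∀ i → 1 ≤ e i) →
    (k : ℕ) → 1 ≤ k → ∃[ N ] (∀ (n : ℕ) → N ≤ n →
      ∀ (B : List (BoolFun n)) → Distinct B →
        All (Bad n (λ i → p i ^ e i) (maxFin (λ i → p i ^ e i))) B →
        ∃[ G ] (Distinct {n} G × All (NonSymmetric {n}) G × k * length B ≤ length G))
mainTheorem8 (suc r) _ p e p-prime _ e≥1 k _ = 2 ^ (6 + (k + q₀)) , λ n N≤n B B! bad →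
  let L , 2^L≤n , n<2^L+1 = ∃-log₂ n (≤-trans (m^n>0 2 (6 + (k + q₀))) N≤n)
  in lowDegree-outnumbered 2≤q₀ k L N≤n 2^L≤n n<2^L+1 B! (All.map (bad⇒lowDegreeRep 1≤M n<2^L+1) bad)
  where
  q : Fin (suc r) → ℕ
  q i = p i ^ e i
  q₀ : ℕ
  q₀ = q F.zero
  2≤q₀ : 2 ≤ q₀
  2≤q₀ = 2≤prime^ (p-prime F.zero) (e≥1 F.zero)
  1≤M : 1 ≤ maxFin q
  1≤M = ≤-trans (≤-trans (s≤s z≤n) 2≤q₀) (m≤m⊔n q₀ _)
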